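{- Let $\pi$ be a permutation of rank $n$ and let $v=(v_0,v_1,\dots,v_{n-1},v_n)$ be its augmented non-inversion zone-crossing vector. Then for $1\le k\le n$, \[\pi_k=n-(k-1)-(v_k-v_{k-1}).\] Consequently, if $\rho$ is a permutation of rank $n$ with the same augmented non-inversion zone-crossing vector as $\pi$, then $\pi=\rho$.
   Context: A permutation of rank $n$ is a bijection $\pi$ of $\{1,\dots,n\}$, $\pi_k=\pi(k)$. A non-inversion of $\pi$ is a pair $(a,b)$ with $1\le a<b\le n$ and $\pi(a)<\pi(b)$. The non-inversion zone-crossing vector of $\pi$ is $(z_1,\dots,z_{n-1})$, where $z_k$ is the number of non-inversions $(a,b)$ with $a\le k<b$; the augmented vector is $(0,z_1,\dots,z_{n-1},0)$, indexed from $0$ to $n$. -}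

module Defs where

open import Data.Nat using (ℕ; zero; suc; _<_; _≤_; _<?_; _≤?_; _≟_)
open import Data.Fin using (Fin; toℕ)
open import Data.Fin.Permutation using (Permutation′; _⟨$⟩ʳ_)
open import Data.List using (List; length; filter; allFin; cartesianProduct)
open import Data.Product using (_×_; _,_; proj₁; proj₂)
open import Relation.Nullary.Decidable using (_×-dec_; does)
open import Data.Bool using (if_then_else_)

-- A permutation of rank n is a bijection of Fin n = {0,…,n-1}; the paper's
-- position k (1-based) is Fin index k-1, and the paper's value π(k) is
-- toℕ (π ⟨$⟩ʳ (k-1)) + 1.

pairs : (n : ℕ) → List (Fin n × Fin n)
pairs n = cartesianProduct (allFin n) (allFin n)

-- z_k: number of non-inversions (a,b), a<b, π a < π b, with a ≤ k < b in the
-- paper's 1-based indexing, i.e. 0-based: toℕ a < k ≤ toℕ b.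
-- (toℕ a < toℕ b follows from these two conditions.)
zoneCrossing : {n : ℕ} → Permutation′ n → ℕ → ℕ
zoneCrossing {n} π k =
  length (filter
    (λ p → (toℕ (proj₁ p) <? toℕ (proj₂ p)) ×-dec
           ((toℕ (π ⟨$⟩ʳ proj₁ p) <? toℕ (π ⟨$⟩ʳ proj₂ p)) ×-dec
           ((toℕ (proj₁ p) <? k) ×-dec (k ≤? toℕ (proj₂ p)))))
    (pairs n))

-- Augmented vector (v_0,…,v_n) as a function of the index k ∈ {0,…,n}:
-- v_0 = v_n = 0 and v_k = z_k for 1 ≤ k ≤ n-1.
-- (Values at indices k > n are irrelevant and set to 0.)
augVec : {n : ℕ} → Permutation′ n → ℕ → ℕ
augVec {n} π zero = 0
augVec {n} π (suc k) = if does (suc k <? n) then zoneCrossing π (suc k) else 0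

-- Work with 0-based positions and values. Moving the cut from k to k+1 gains
-- the non-inversions (k , b) with b > k and loses the non-inversions (a , k)
-- with a < k. With p = π k these number R = #{b > k ∣ π b > p} and
-- L = #{a < k ∣ π a < p}. Let G = #{a < k ∣ π a > p}; then L + G = k, and
-- R + G = n - 1 - p because each of the n - 1 - p values above p sits before
-- or after position k. Hence v_{k+1} - v_k = R - L = n - 1 - p - k, so the
-- augmented vector determines every value of π.
module Submission where

open import Defs
open import Data.Bool using (Bool; true; false; T; _∧_)
open import Data.Bool.Properties using (∧-assoc; ∧-comm; ∧-zeroʳ; ∧-identityʳ)
open import Data.Empty using (⊥-elim)
open import Data.Fin using (Fin; toℕ; zero; suc)
open import Data.Fin.Permutation using (Permutation′; _⟨$⟩ʳ_)
open import Data.Fin.Properties using (toℕ<n; toℕ-injective)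
open import Data.Integer using (ℤ; +_; _-_)
import Data.Integer as ℤ
import Data.Integer.Properties as ℤₚ
open import Data.Integer.Tactic.RingSolver using (solve-∀)
open import Data.List using (length; filter; map; tabulate; cartesianProduct; _++_)
open import Data.List.Properties using (length-++; filter-++; map-tabulate)
open import Data.Nat
open import Data.Nat.Properties
open import Algebra.Properties.CommutativeMonoid.Sum +-0-commutativeMonoid
  using (sum; sum-syntax; ∑-distrib-+; ∑-comm; sum-permute; sum-cong-≗; sum-replicate-zero)
open import Data.Product using (_×_; _,_)
open import Function using (_∘_; id)
open import Function.Bundles using (Injection)
open import Function.Properties.Inverse using (↔⇒↣)
open import Relation.Binary using (tri<; tri≈; tri>)
open import Relation.Binary.PropositionalEquality
open import Relation.Nullary using (¬_; does)
open import Relation.Nullary.Decidable using (dec-true; dec-false)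
open import Relation.Unary using (Pred; Decidable)

⟦_⟧ : Bool → ℕ
⟦ true ⟧  = 1
⟦ false ⟧ = 0

module _ {p} {A : Set} {P : Pred A p} (P? : Decidable P) where

  length-filter-tabulate : ∀ {m} (f : Fin m → A) →
    length (filter P? (tabulate f)) ≡ ∑[ i < m ] ⟦ does (P? (f i)) ⟧
  length-filter-tabulate {zero}  f = refl
  length-filter-tabulate {suc m} f with does (P? (f zero))
  ... | true  = cong suc (length-filter-tabulate (f ∘ suc))
  ... | false = length-filter-tabulate (f ∘ suc)

module _ {p} {A B : Set} {P : Pred (A × B) p} (P? : Decidable P) where

  length-filter-cartesianProduct : ∀ {m n} (f : Fin m → A) (g : Fin n → B) →
    length (filter P? (cartesianProduct (tabulate f) (tabulate g)))
      ≡ ∑[ i < m ] ∑[ j < n ] ⟦ does (P? (f i , g j)) ⟧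
  length-filter-cartesianProduct {zero}  f g = refl
  length-filter-cartesianProduct {suc m} f g = begin
    length (filter P? (row ++ rest))                   ≡⟨ cong length (filter-++ P? row rest) ⟩
    length (filter P? row ++ filter P? rest)           ≡⟨ length-++ (filter P? row) ⟩
    length (filter P? row) + length (filter P? rest)   ≡⟨ cong₂ _+_ count-row (length-filter-cartesianProduct (f ∘ suc) g) ⟩
    _                                                  ∎
    where
    open ≡-Reasoning
    row  = map (f zero ,_) (tabulate g)
    rest = cartesianProduct (tabulate (f ∘ suc)) (tabulate g)
    count-row : length (filter P? row) ≡ ∑[ j < _ ] ⟦ does (P? (f zero , g j)) ⟧
    count-row = trans (cong (length ∘ filter P?) (map-tabulate g (f zero ,_)))
                      (length-filter-tabulate P? ((f zero ,_) ∘ g))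

∑-zero : ∀ {n} {f : Fin n → ℕ} → (∀ i → f i ≡ 0) → ∑[ i < n ] f i ≡ 0
∑-zero {n} f≗0 = trans (sum-cong-≗ f≗0) (sum-replicate-zero n)

∑∑-distrib-+ : ∀ {m n} (f g : Fin m → Fin n → ℕ) →
  ∑[ i < m ] ∑[ j < n ] (f i j + g i j) ≡ ∑[ i < m ] ∑[ j < n ] f i j + ∑[ i < m ] ∑[ j < n ] g i j
∑∑-distrib-+ {n = n} f g = trans (sum-cong-≗ λ i → ∑-distrib-+ (f i) (g i))
  (∑-distrib-+ (λ i → ∑[ j < n ] f i j) (λ i → ∑[ j < n ] g i j))

∑-one : ∀ n → ∑[ i < n ] 1 ≡ n
∑-one zero    = refl
∑-one (suc n) = cong suc (∑-one n)

∑-⟦toℕ<ᵇ⟧ : ∀ n k → k ≤ n → ∑[ a < n ] ⟦ toℕ a <ᵇ k ⟧ ≡ k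
∑-⟦toℕ<ᵇ⟧ zero    zero    _         = refl
∑-⟦toℕ<ᵇ⟧ (suc n) zero    _         = ∑-zero {suc n} (λ _ → refl)
∑-⟦toℕ<ᵇ⟧ (suc n) (suc k) (s≤s k≤n) = cong suc (∑-⟦toℕ<ᵇ⟧ n k k≤n)

∑-⟦<ᵇtoℕ⟧ : ∀ n q → ∑[ a < n ] ⟦ q <ᵇ toℕ a ⟧ ≡ n ∸ suc q
∑-⟦<ᵇtoℕ⟧ zero    q       = refl
∑-⟦<ᵇtoℕ⟧ (suc n) zero    = ∑-one n
∑-⟦<ᵇtoℕ⟧ (suc n) (suc q) = ∑-⟦<ᵇtoℕ⟧ n q

∑-⟦∧≡ᵇ⟧ : ∀ {n} (g : Fin n → Bool) (i : Fin n) →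
  ∑[ a < n ] ⟦ g a ∧ (toℕ a ≡ᵇ toℕ i) ⟧ ≡ ⟦ g i ⟧
∑-⟦∧≡ᵇ⟧ {suc n} g zero = begin
  ⟦ g zero ∧ true ⟧ + ∑[ a < n ] ⟦ g (suc a) ∧ false ⟧
    ≡⟨ cong₂ _+_ (cong ⟦_⟧ (∧-identityʳ (g zero))) (∑-zero (cong ⟦_⟧ ∘ ∧-zeroʳ ∘ g ∘ suc)) ⟩
  ⟦ g zero ⟧ + 0
    ≡⟨ +-identityʳ _ ⟩
  ⟦ g zero ⟧ ∎
  where open ≡-Reasoning
∑-⟦∧≡ᵇ⟧ {suc n} g (suc i) =
  cong₂ _+_ (cong ⟦_⟧ (∧-zeroʳ (g zero))) (∑-⟦∧≡ᵇ⟧ (g ∘ suc) i)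

module _ {m n : ℕ} where

  <ᵇ-true : m < n → (m <ᵇ n) ≡ true
  <ᵇ-true = dec-true (m <? n)

  <ᵇ-false : ¬ m < n → (m <ᵇ n) ≡ false
  <ᵇ-false = dec-false (m <? n)

  ≤ᵇ-true : m ≤ n → (m ≤ᵇ n) ≡ true
  ≤ᵇ-true = dec-true (m ≤? n)

  ≤ᵇ-false : ¬ m ≤ n → (m ≤ᵇ n) ≡ false
  ≤ᵇ-false = dec-false (m ≤? n)

  ≡ᵇ-true : m ≡ n → (m ≡ᵇ n) ≡ true
  ≡ᵇ-true = dec-true (m ≟ n)

  ≡ᵇ-false : m ≢ n → (m ≡ᵇ n) ≡ false
  ≡ᵇ-false = dec-false (m ≟ n)

⟦<ᵇ⟧+⟦>ᵇ⟧ : ∀ {u v} → u ≢ v → ⟦ u <ᵇ v ⟧ + ⟦ v <ᵇ u ⟧ ≡ 1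
⟦<ᵇ⟧+⟦>ᵇ⟧ {u} {v} u≢v with <-cmp u v
... | tri< u<v _ _ rewrite <ᵇ-true u<v | <ᵇ-false (<⇒≯ u<v) = refl
... | tri≈ _ u≡v _ = ⊥-elim (u≢v u≡v)
... | tri> _ _ v<u rewrite <ᵇ-false (<⇒≯ v<u) | <ᵇ-true v<u = refl

⟦∧⟧-split : ∀ c {x y} → (T c → ⟦ x ⟧ + ⟦ y ⟧ ≡ 1) → ⟦ c ∧ x ⟧ + ⟦ c ∧ y ⟧ ≡ ⟦ c ⟧
⟦∧⟧-split true  x+y≡1 = x+y≡1 _
⟦∧⟧-split false _     = refl

⟦∧⟧-cong-+ : ∀ c {x y x′ y′} → (T c → ⟦ x ⟧ + ⟦ y ⟧ ≡ ⟦ x′ ⟧ + ⟦ y′ ⟧) →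
  ⟦ c ∧ x ⟧ + ⟦ c ∧ y ⟧ ≡ ⟦ c ∧ x′ ⟧ + ⟦ c ∧ y′ ⟧
⟦∧⟧-cong-+ true  eq = eq _
⟦∧⟧-cong-+ false _  = refl

crossesᵇ : ℕ → ℕ → ℕ → Bool
crossesᵇ k a b = (a <ᵇ k) ∧ (k ≤ᵇ b)

crossesᵇ-suc : ∀ {a b} k → a < b →
  ⟦ crossesᵇ k a b ⟧ + ⟦ a ≡ᵇ k ⟧ ≡ ⟦ crossesᵇ (suc k) a b ⟧ + ⟦ b ≡ᵇ k ⟧
crossesᵇ-suc {a} {b} k a<b with <-cmp a k
... | tri≈ _ refl _
  rewrite <ᵇ-false (<-irrefl {a} refl) | ≡ᵇ-true {a} refl | <ᵇ-true (n<1+n a)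
        | <ᵇ-true a<b | ≡ᵇ-false (≢-sym (<⇒≢ a<b)) = refl
... | tri> _ a≢k k<a
  rewrite <ᵇ-false (<⇒≯ k<a) | ≡ᵇ-false a≢k | <ᵇ-false (≤⇒≯ k<a)
        | ≡ᵇ-false (≢-sym (<⇒≢ (<-trans k<a a<b))) = refl
... | tri< a<k a≢k _
  rewrite <ᵇ-true a<k | ≡ᵇ-false a≢k | <ᵇ-true (m<n⇒m<1+n a<k) with <-cmp b k
...   | tri< b<k b≢k _ rewrite ≤ᵇ-false (<⇒≱ b<k) | <ᵇ-false (<⇒≯ b<k) | ≡ᵇ-false b≢k = refl
...   | tri≈ _ refl _  rewrite ≤ᵇ-true (≤-refl {b}) | <ᵇ-false (<-irrefl {b} refl) | ≡ᵇ-true {b} refl = refl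
...   | tri> _ b≢k k<b rewrite ≤ᵇ-true (<⇒≤ k<b) | <ᵇ-true k<b | ≡ᵇ-false b≢k = refl

cut-identity : ∀ {z z′ l g r p k n} → z + r ≡ z′ + l → l + g ≡ k → r + g + p ≡ n →
  + p ≡ (+ n - + k) - (+ z′ - + z)
cut-identity {z} {z′} {l} {g} {r} {p} z+r≡z′+l refl refl = sym (begin
  (+ r ℤ.+ + g ℤ.+ + p - (+ l ℤ.+ + g)) - (+ z′ - + z)
    ≡⟨ regroup (+ z) (+ z′) (+ l) (+ g) (+ r) (+ p) ⟩
  + p ℤ.+ (+ (z + r) - + (z′ + l))
    ≡⟨ cong (λ x → + p ℤ.+ (+ x - + (z′ + l))) z+r≡z′+l ⟩
  + p ℤ.+ (+ (z′ + l) - + (z′ + l))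
    ≡⟨ cong (λ x → + p ℤ.+ x) (ℤₚ.+-inverseʳ (+ (z′ + l))) ⟩
  + p ℤ.+ + 0
    ≡⟨ ℤₚ.+-identityʳ (+ p) ⟩
  + p ∎)
  where
  open ≡-Reasoning
  regroup : ∀ (z z′ l g r p : ℤ) →
    (r ℤ.+ g ℤ.+ p - (l ℤ.+ g)) - (z′ - z) ≡ p ℤ.+ ((z ℤ.+ r) - (z′ ℤ.+ l))
  regroup = solve-∀

module _ {n : ℕ} (π : Permutation′ n) where

  value : Fin n → ℕ
  value a = toℕ (π ⟨$⟩ʳ a)

  value-injective : ∀ {a b} → value a ≡ value b → a ≡ b
  value-injective = Injection.injective (↔⇒↣ π) ∘ toℕ-injective

  nonInversionᵇ : Fin n → Fin n → Bool
  nonInversionᵇ a b = (toℕ a <ᵇ toℕ b) ∧ (value a <ᵇ value b)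

  zoneCrossing-∑ : ∀ k → zoneCrossing π k
    ≡ ∑[ a < n ] ∑[ b < n ] ⟦ nonInversionᵇ a b ∧ crossesᵇ k (toℕ a) (toℕ b) ⟧
  zoneCrossing-∑ k = begin
    zoneCrossing π k
      ≡⟨ length-filter-cartesianProduct _ {n} {n} id id ⟩
    ∑[ a < n ] ∑[ b < n ] ⟦ (toℕ a <ᵇ toℕ b) ∧ ((value a <ᵇ value b) ∧ crossesᵇ k (toℕ a) (toℕ b)) ⟧
      ≡⟨ sum-cong-≗ (λ a → sum-cong-≗ λ b → cong ⟦_⟧ (∧-assoc (toℕ a <ᵇ toℕ b) (value a <ᵇ value b) (crossesᵇ k (toℕ a) (toℕ b)))) ⟨
    ∑[ a < n ] ∑[ b < n ] ⟦ nonInversionᵇ a b ∧ crossesᵇ k (toℕ a) (toℕ b) ⟧ ∎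
    where open ≡-Reasoning

  zoneCrossing≡0 : ∀ k → (∀ a b → crossesᵇ k (toℕ a) (toℕ b) ≡ false) →
    zoneCrossing π k ≡ 0
  zoneCrossing≡0 k no-crossing = trans (zoneCrossing-∑ k)
    (∑-zero λ a → ∑-zero λ b →
      trans (cong (λ c → ⟦ nonInversionᵇ a b ∧ c ⟧) (no-crossing a b)) (cong ⟦_⟧ (∧-zeroʳ _)))

  augVec≡zoneCrossing : ∀ k → k ≤ n → augVec π k ≡ zoneCrossing π k
  augVec≡zoneCrossing zero _ = sym (zoneCrossing≡0 0 λ _ _ → refl)
  augVec≡zoneCrossing (suc k) k<n with <-cmp (suc k) n
  ... | tri< 1+k<n _ _ rewrite <ᵇ-true 1+k<n = refl
  ... | tri≈ _ refl _ rewrite <ᵇ-false (<-irrefl {suc k} refl) =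
    sym (zoneCrossing≡0 (suc k) λ a b →
      trans (cong ((toℕ a <ᵇ suc k) ∧_) (≤ᵇ-false (<⇒≱ (toℕ<n b)))) (∧-zeroʳ _))
  ... | tri> _ _ n<k = ⊥-elim (<⇒≱ n<k k<n)

  module _ (i : Fin n) where

    private
      before after smaller larger : Fin n → Bool
      before  a = toℕ a <ᵇ toℕ i
      after   a = toℕ i <ᵇ toℕ a
      smaller a = value a <ᵇ value i
      larger  a = value i <ᵇ value a

    smallerBefore largerBefore largerAfter : ℕ
    smallerBefore = ∑[ a < n ] ⟦ before a ∧ smaller a ⟧
    largerBefore  = ∑[ a < n ] ⟦ before a ∧ larger a ⟧
    largerAfter   = ∑[ a < n ] ⟦ after a ∧ larger a ⟧

    zoneCrossing-suc :
      zoneCrossing π (toℕ i) + largerAfter ≡ zoneCrossing π (suc (toℕ i)) + smallerBefore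
    zoneCrossing-suc = begin
      zoneCrossing π k + largerAfter
        ≡⟨ cong₂ _+_ (zoneCrossing-∑ k) (sym startingAt) ⟩
      ∑[ a < n ] ∑[ b < n ] crossing k a b + ∑[ a < n ] ∑[ b < n ] starting a b
        ≡⟨ ∑∑-distrib-+ (crossing k) starting ⟨
      ∑[ a < n ] ∑[ b < n ] (crossing k a b + starting a b)
        ≡⟨ sum-cong-≗ (λ a → sum-cong-≗ λ b → ⟦∧⟧-cong-+ (nonInversionᵇ a b)
             (crossesᵇ-suc k ∘ <ᵇ⇒< (toℕ a) (toℕ b) ∘ proj-T₁ (toℕ a <ᵇ toℕ b))) ⟩
      ∑[ a < n ] ∑[ b < n ] (crossing (suc k) a b + ending a b)
        ≡⟨ ∑∑-distrib-+ (crossing (suc k)) ending ⟩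
      ∑[ a < n ] ∑[ b < n ] crossing (suc k) a b + ∑[ a < n ] ∑[ b < n ] ending a b
        ≡⟨ cong₂ _+_ (sym (zoneCrossing-∑ (suc k))) endingAt ⟩
      zoneCrossing π (suc k) + smallerBefore ∎
      where
      open ≡-Reasoning
      k = toℕ i
      crossing : ℕ → Fin n → Fin n → ℕ
      crossing c a b = ⟦ nonInversionᵇ a b ∧ crossesᵇ c (toℕ a) (toℕ b) ⟧
      starting ending : Fin n → Fin n → ℕ
      starting a b = ⟦ nonInversionᵇ a b ∧ (toℕ a ≡ᵇ k) ⟧
      ending   a b = ⟦ nonInversionᵇ a b ∧ (toℕ b ≡ᵇ k) ⟧
      proj-T₁ : ∀ x {y} → T (x ∧ y) → T x
      proj-T₁ true _ = _
      startingAt : ∑[ a < n ] ∑[ b < n ] starting a b ≡ largerAfter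
      startingAt = trans (∑-comm starting) (sum-cong-≗ λ b → ∑-⟦∧≡ᵇ⟧ (λ a → nonInversionᵇ a b) i)
      endingAt : ∑[ a < n ] ∑[ b < n ] ending a b ≡ smallerBefore
      endingAt = sum-cong-≗ λ a → ∑-⟦∧≡ᵇ⟧ (nonInversionᵇ a) i

    smallerBefore+largerBefore : smallerBefore + largerBefore ≡ toℕ i
    smallerBefore+largerBefore = begin
      smallerBefore + largerBefore
        ≡⟨ ∑-distrib-+ (λ a → ⟦ before a ∧ smaller a ⟧) (λ a → ⟦ before a ∧ larger a ⟧) ⟨
      ∑[ a < n ] (⟦ before a ∧ smaller a ⟧ + ⟦ before a ∧ larger a ⟧)
        ≡⟨ sum-cong-≗ (λ a → ⟦∧⟧-split (before a) λ a<i →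
             ⟦<ᵇ⟧+⟦>ᵇ⟧ (<⇒≢ (<ᵇ⇒< _ _ a<i) ∘ cong toℕ ∘ value-injective)) ⟩
      ∑[ a < n ] ⟦ before a ⟧
        ≡⟨ ∑-⟦toℕ<ᵇ⟧ n (toℕ i) (<⇒≤ (toℕ<n i)) ⟩
      toℕ i ∎
      where open ≡-Reasoning

    largerAfter+largerBefore : largerAfter + largerBefore ≡ n ∸ suc (value i)
    largerAfter+largerBefore = begin
      largerAfter + largerBefore
        ≡⟨ cong₂ _+_ (sum-cong-≗ λ a → cong ⟦_⟧ (∧-comm (after a) (larger a)))
                     (sum-cong-≗ λ a → cong ⟦_⟧ (∧-comm (before a) (larger a))) ⟩
      ∑[ a < n ] ⟦ larger a ∧ after a ⟧ + ∑[ a < n ] ⟦ larger a ∧ before a ⟧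
        ≡⟨ ∑-distrib-+ (λ a → ⟦ larger a ∧ after a ⟧) (λ a → ⟦ larger a ∧ before a ⟧) ⟨
      ∑[ a < n ] (⟦ larger a ∧ after a ⟧ + ⟦ larger a ∧ before a ⟧)
        ≡⟨ sum-cong-≗ (λ a → ⟦∧⟧-split (larger a) λ i<a →
             ⟦<ᵇ⟧+⟦>ᵇ⟧ (λ i≡a → <⇒≢ (<ᵇ⇒< _ _ i<a) (cong value (toℕ-injective i≡a)))) ⟩
      ∑[ a < n ] ⟦ larger a ⟧
        ≡⟨ sum-permute (λ c → ⟦ value i <ᵇ toℕ c ⟧) π ⟨
      ∑[ c < n ] ⟦ value i <ᵇ toℕ c ⟧
        ≡⟨ ∑-⟦<ᵇtoℕ⟧ n (value i) ⟩
      n ∸ suc (value i) ∎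
      where open ≡-Reasoning

    value-from-zoneCrossing : + suc (value i)
      ≡ (+ n - + toℕ i) - (+ zoneCrossing π (suc (toℕ i)) - + zoneCrossing π (toℕ i))
    value-from-zoneCrossing =
      cut-identity {zoneCrossing π (toℕ i)} {zoneCrossing π (suc (toℕ i))} {smallerBefore} {largerBefore} {largerAfter}
        zoneCrossing-suc smallerBefore+largerBefore
      (trans (cong (_+ suc (value i)) largerAfter+largerBefore) (m∸n+n≡m (toℕ<n (π ⟨$⟩ʳ i))))

    value-from-augVec : + suc (value i)
      ≡ (+ n - + toℕ i) - (+ augVec π (suc (toℕ i)) - + augVec π (toℕ i))
    value-from-augVec
      rewrite augVec≡zoneCrossing (suc (toℕ i)) (toℕ<n i)
            | augVec≡zoneCrossing (toℕ i) (<⇒≤ (toℕ<n i)) = value-from-zoneCrossing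

augVec-injective : ∀ {n} (π ρ : Permutation′ n) →
  (∀ k → k ≤ n → augVec π k ≡ augVec ρ k) → ∀ i → π ⟨$⟩ʳ i ≡ ρ ⟨$⟩ʳ i
augVec-injective {n} π ρ same i = toℕ-injective (suc-injective (ℤₚ.+-injective (begin
  + suc (value π i)
    ≡⟨ value-from-augVec π i ⟩
  (+ n - + toℕ i) - (+ augVec π (suc (toℕ i)) - + augVec π (toℕ i))
    ≡⟨ cong₂ (λ x y → (+ n - + toℕ i) - (+ x - + y)) (same (suc (toℕ i)) (toℕ<n i)) (same (toℕ i) (<⇒≤ (toℕ<n i))) ⟩
  (+ n - + toℕ i) - (+ augVec ρ (suc (toℕ i)) - + augVec ρ (toℕ i))
    ≡⟨ value-from-augVec ρ i ⟨
  + suc (value ρ i) ∎)))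
  where open ≡-Reasoning

proposition3p3 : (n : ℕ) → (π : Permutation′ n) →
    ((i : Fin n) →
    + suc (toℕ (π ⟨$⟩ʳ i))
    ≡ (+ n - + toℕ i) - (+ augVec π (suc (toℕ i)) - + augVec π (toℕ i)))
    × ((ρ : Permutation′ n) →
    ((k : ℕ) → k ≤ n → augVec π k ≡ augVec ρ k) →
    (i : Fin n) → π ⟨$⟩ʳ i ≡ ρ ⟨$⟩ʳ i)
proposition3p3 n π = value-from-augVec π , augVec-injective π
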